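{- Let $n$ be a positive integer and let $G = \mathrm{Kneser}(n,2)$. Then $$\mathrm{tw}(G) = \begin{cases} 0 & \text{if } n \leq 3,\\ 1 & \text{if } n = 4,\\ 4 & \text{if } n = 5,\\ \binom{n-1}{2} - 1 & \text{if } n \geq 6.\end{cases}$$
   Context: For positive integers $n,k$, the Kneser graph $\mathrm{Kneser}(n,k)$ has as vertex set the family of all $k$-element subsets of $[n]=\{1,\dots,n\}$, with two vertices adjacent if and only if they are disjoint sets. A tree decomposition of a graph $G$ is a pair $(T,(B_x)_{x\in V(T)})$ with $T$ a tree and $B_x\subseteq V(G)$, such that for each vertex $v$ the nodes $x$ with $v\in B_x$ induce a non-empty connected subtree of $T$, and each edge of $G$ has both ends in some bag $B_x$. Its width is $\max_x |B_x| - 1$, and the treewidth $\mathrm{tw}(G)$ is the minimum width of a tree decomposition of $G$. -}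

module Defs where

open import Data.Nat using (ℕ; zero; suc; _≤_)
open import Data.Fin using (Fin; zero; suc; toℕ)
open import Data.Fin.Subset using (Subset; _∩_; ∣_∣; Empty)
open import Data.List using (List; length)
open import Data.List.Membership.Propositional using (_∈_)
open import Data.List.Relation.Unary.Unique.Propositional using (Unique)
open import Data.Product using (Σ; ∃; _×_; _,_; proj₁)
open import Data.Sum using (_⊎_)
open import Relation.Binary.PropositionalEquality using (_≡_)

record Graph : Set₁ where
  field
    V   : Set
    Adj : V → V → Set

open Graph public

Kneser : ℕ → ℕ → Graph
Kneser n k = record
  { V   = Σ (Subset n) (λ s → ∣ s ∣ ≡ k)
  ; Adj = λ s t → Empty (proj₁ s ∩ proj₁ t)
  }

-- A finite tree on node set Fin (suc m), given by a parent map: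
-- node (suc i) has parent (parent i), whose index is ≤ i.
-- Every finite tree is isomorphic to one of this form (label in BFS order).
record Tree : Set where
  field
    m        : ℕ
    parent   : Fin m → Fin (suc m)
    parent<  : ∀ i → toℕ (parent i) ≤ toℕ i

open Tree public

Node : Tree → Set
Node T = Fin (suc (m T))

TEdge : (T : Tree) → Node T → Node T → Set
TEdge T x y = (∃ λ i → x ≡ suc i × y ≡ parent T i)
            ⊎ (∃ λ i → y ≡ suc i × x ≡ parent T i)

data WalkIn (T : Tree) (S : Node T → Set) : Node T → Node T → Set where
  here : ∀ {x} → S x → WalkIn T S x x
  step : ∀ {x y z} → S x → TEdge T x y → WalkIn T S y z → WalkIn T S x z

ConnectedNonempty : (T : Tree) → (Node T → Set) → Set
ConnectedNonempty T S = (∃ λ x → S x) × (∀ x y → S x → S y → WalkIn T S x y)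

record TreeDecomposition (G : Graph) : Set₁ where
  field
    tree     : Tree
    bag      : Node tree → List (V G)
    bagUniq  : ∀ x → Unique (bag x)
    vertexOK : ∀ (v : V G) → ConnectedNonempty tree (λ x → v ∈ bag x)
    edgeOK   : ∀ (u v : V G) → Adj G u v → ∃ λ x → u ∈ bag x × v ∈ bag x

open TreeDecomposition public

WidthAtMost : ∀ {G} → TreeDecomposition G → ℕ → Set
WidthAtMost D k = ∀ x → length (bag D x) ≤ suc k

TreewidthIs : Graph → ℕ → Set₁
TreewidthIs G k =
  (Σ (TreeDecomposition G) λ D → WidthAtMost D k) ×
  (∀ (D : TreeDecomposition G) (k' : ℕ) → WidthAtMost D k' → k ≤ k')

-- Upper bounds: for n ≥ 6 take a star whose root bag holds the C(n-1,2) pairs avoiding the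
-- point 0 and whose leaf at j holds {0,j} and the pairs avoiding 0 and j; for n ≤ 5 explicit
-- decompositions are verified by computation.
--
-- Lower bound: the paths x ~ y ~ z and the edges p ~ q with max p < min q form a bramble
-- (any two of them are joined by an edge), so no tree decomposition can give every node a
-- bramble element avoiding its bag. But the pairs outside a bag with at most B elements
-- always contain a bramble element once 6 + B ≤ C(n,2) and n + B ≤ C(n,2): a set of pairs
-- without one either contains an edge, and then has at most 5 elements, or is intersecting,
-- and then is a star (fewer than n) or a triangle. Hence the width is at least
-- C(n,2) - max(6,n), which is C(n-1,2) - 1 for n ≥ 6 and 4 for n = 5.

module Submission where

open import Defs
open import Data.Bool using (true; false)
import Data.Bool.Properties as Bool
open import Data.Empty using (⊥; ⊥-elim)
open import Data.Fin using (Fin; zero; suc; toℕ; #_; _<_)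
import Data.Fin.Properties as Fin
open import Data.Fin.Subset using (Subset; _∩_; _∪_; ∣_∣; ⁅_⁆)
  renaming (_∈_ to _∈ₛ_; _∉_ to _∉ₛ_)
open import Data.Fin.Subset.Properties
  using (_∈?_; x∈p∩q⁺; x∈p∩q⁻; ⊆-antisym; nonempty?; x∈⁅x⁆; x∈⁅y⁆⇒x≡y; ∣⁅x⁆∣≡1)
open import Data.List using (List; []; _∷_; length; map; _++_; filter; allFin)
open import Data.List.Membership.Propositional using (_∈_; _∉_; find; lose)
open import Data.List.Membership.Propositional.Properties
  using (∈-map⁺; ∈-map⁻; ∈-++⁺ˡ; ∈-++⁺ʳ; ∈-++⁻; ∈-∃++; ∈-filter⁺; ∈-filter⁻; ∈-allFin)
open import Data.List.Properties using (length-map; length-++; length-tabulate; filter-notAll)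
open import Data.List.Relation.Binary.Subset.Propositional using (_⊆_)
open import Data.List.Relation.Unary.All as All using (All; []; _∷_)
open import Data.List.Relation.Unary.All.Properties using (¬All⇒Any¬)
open import Data.List.Relation.Unary.AllPairs using ([]; _∷_)
open import Data.List.Relation.Unary.Any using (here; there; any?)
open import Data.List.Relation.Unary.Unique.Propositional using (Unique)
import Data.List.Relation.Unary.Unique.Propositional.Properties as Unique
open import Data.Nat as ℕ using (ℕ; zero; suc; pred; _+_; _∸_; _≤_; z≤n; s≤s; _≤?_)
  renaming (_<_ to _<ℕ_)
open import Data.Nat.Combinatorics using (_C_; nCk+nC[k+1]≡[n+1]C[k+1]; nC1≡n)
open import Data.Nat.Properties
  using (≡-irrelevant; ≤⇒≯; ≰⇒>; n≤1+n; ≤-refl; ≤-reflexive; ≤-trans; ≤-pred; ≤-<-trans;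
         +-identityʳ; +-suc; +-comm; +-monoˡ-≤; +-monoʳ-≤; +-cancelʳ-≤; module ≤-Reasoning)
open import Data.Product using (Σ; ∃; _×_; _,_; proj₁; proj₂; uncurry)
open import Data.Sum using (_⊎_; inj₁; inj₂; [_,_]′)
open import Data.Unit using (tt)
open import Data.Vec using (Vec; []; _∷_; here; there; tail; lookup)
import Data.Vec.Properties as Vec
open import Function using (_∘_)
open import Relation.Binary.Definitions using (DecidableEquality; tri<; tri≈; tri>)
open import Relation.Binary.PropositionalEquality
  using (_≡_; _≢_; refl; sym; trans; cong; cong₂; subst; subst₂; ≢-sym; module ≡-Reasoning)
open import Relation.Nullary using (¬_; Dec; yes; no; ¬?)
open import Relation.Nullary.Decidable using (True; toWitness; map′; _×-dec_; _⊎-dec_; _→-dec_)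

∣p∣≡0⇒x∉p : ∀ {n} (s : Subset n) → ∣ s ∣ ≡ 0 → ∀ {x} → x ∉ₛ s
∣p∣≡0⇒x∉p (true ∷ s) () _
∣p∣≡0⇒x∉p (false ∷ s) eq (there x∈s) = ∣p∣≡0⇒x∉p s eq x∈s

∣p∣≡1⇒x≡y : ∀ {n} (s : Subset n) → ∣ s ∣ ≡ 1 → ∀ {x y} → x ∈ₛ s → y ∈ₛ s → x ≡ y
∣p∣≡1⇒x≡y (true ∷ s) eq here here = refl
∣p∣≡1⇒x≡y (true ∷ s) eq here (there y∈s) = ⊥-elim (∣p∣≡0⇒x∉p s (cong pred eq) y∈s)
∣p∣≡1⇒x≡y (true ∷ s) eq (there x∈s) _ = ⊥-elim (∣p∣≡0⇒x∉p s (cong pred eq) x∈s)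
∣p∣≡1⇒x≡y (false ∷ s) eq (there x∈s) (there y∈s) = cong suc (∣p∣≡1⇒x≡y s eq x∈s y∈s)

∣p∣≡suc⇒nonempty : ∀ {n k} (s : Subset n) → ∣ s ∣ ≡ suc k → ∃ λ x → x ∈ₛ s
∣p∣≡suc⇒nonempty (true ∷ s) eq = zero , here
∣p∣≡suc⇒nonempty (false ∷ s) eq with x , x∈s ← ∣p∣≡suc⇒nonempty s eq = suc x , there x∈s

∣p∣≡1⇒p≡⁅x⁆ : ∀ {n} (s : Subset n) → ∣ s ∣ ≡ 1 → ∃ λ x → s ≡ ⁅ x ⁆
∣p∣≡1⇒p≡⁅x⁆ s eq with x , x∈s ← ∣p∣≡suc⇒nonempty s eq =
  x , ⊆-antisym (λ y∈s → subst (_∈ₛ ⁅ x ⁆) (sym (∣p∣≡1⇒x≡y s eq y∈s x∈s)) (x∈⁅x⁆ x))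
                (λ y∈⁅x⁆ → subst (_∈ₛ s) (sym (x∈⁅y⁆⇒x≡y x y∈⁅x⁆)) x∈s)

∣p∣≡2⇒x≡a⊎x≡b : ∀ {n} (s : Subset n) → ∣ s ∣ ≡ 2 → ∀ {a b x} →
                a ≢ b → a ∈ₛ s → b ∈ₛ s → x ∈ₛ s → x ≡ a ⊎ x ≡ b
∣p∣≡2⇒x≡a⊎x≡b (true ∷ s) eq a≢b here here _ = ⊥-elim (a≢b refl)
∣p∣≡2⇒x≡a⊎x≡b (true ∷ s) eq _ here _ here = inj₁ refl
∣p∣≡2⇒x≡a⊎x≡b (true ∷ s) eq _ here (there b∈s) (there x∈s) =
  inj₂ (cong suc (∣p∣≡1⇒x≡y s (cong pred eq) x∈s b∈s))
∣p∣≡2⇒x≡a⊎x≡b (true ∷ s) eq _ (there a∈s) here here = inj₂ refl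
∣p∣≡2⇒x≡a⊎x≡b (true ∷ s) eq _ (there a∈s) here (there x∈s) =
  inj₁ (cong suc (∣p∣≡1⇒x≡y s (cong pred eq) x∈s a∈s))
∣p∣≡2⇒x≡a⊎x≡b (true ∷ s) eq a≢b (there a∈s) (there b∈s) _ =
  ⊥-elim (a≢b (cong suc (∣p∣≡1⇒x≡y s (cong pred eq) a∈s b∈s)))
∣p∣≡2⇒x≡a⊎x≡b (false ∷ s) eq a≢b (there a∈s) (there b∈s) (there x∈s)
  with ∣p∣≡2⇒x≡a⊎x≡b s eq (a≢b ∘ cong suc) a∈s b∈s x∈s
... | inj₁ x≡a = inj₁ (cong suc x≡a)
... | inj₂ x≡b = inj₂ (cong suc x≡b)

Pair : ℕ → Set
Pair n = V (Kneser n 2)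

infix 4 _∈ᵖ_ _∉ᵖ_ _~_ _≺_

_∈ᵖ_ : ∀ {n} → Fin n → Pair n → Set
i ∈ᵖ u = i ∈ₛ proj₁ u

_∉ᵖ_ : ∀ {n} → Fin n → Pair n → Set
i ∉ᵖ u = ¬ i ∈ᵖ u

-- Adjacency of Kneser(n,2) as a record, so that u and v can be inferred from a proof of u ~ v.
record _~_ {n} (u v : Pair n) : Set where
  constructor disjoint
  field
    ~⇒∉ : ∀ {x} → x ∈ᵖ u → x ∉ᵖ v

open _~_

Pair-≡ : ∀ {n} {u v : Pair n} → proj₁ u ≡ proj₁ v → u ≡ v
Pair-≡ {u = s , p} {v = .s , q} refl = cong (s ,_) (≡-irrelevant p q)

_≟ᵖ_ : ∀ {n} → DecidableEquality (Pair n)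
u ≟ᵖ v = map′ Pair-≡ (cong proj₁) (Vec.≡-dec Bool._≟_ (proj₁ u) (proj₁ v))

record Spans {n} (u : Pair n) (a b : Fin n) : Set where
  constructor spans
  field
    distinct : a ≢ b
    ∈₁       : a ∈ᵖ u
    ∈₂       : b ∈ᵖ u

Spans-swap : ∀ {n} {u : Pair n} {a b} → Spans u a b → Spans u b a
Spans-swap (spans a≢b a∈u b∈u) = spans (≢-sym a≢b) b∈u a∈u

Spans? : ∀ {n} (u : Pair n) a b → Dec (Spans u a b)
Spans? u a b =
  map′ (λ (a≢b , a∈u , b∈u) → spans a≢b a∈u b∈u) (λ (spans a≢b a∈u b∈u) → a≢b , a∈u , b∈u)
       (¬? (a Fin.≟ b) ×-dec (a ∈? proj₁ u) ×-dec (b ∈? proj₁ u))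

elements : ∀ {n} (u : Pair n) → ∃ λ a → ∃ λ b → Spans u a b
elements (true ∷ s , eq) with x , x∈s ← ∣p∣≡suc⇒nonempty s (cong pred eq) =
  zero , suc x , spans (λ ()) here (there x∈s)
elements (false ∷ s , eq) with a , b , spans a≢b a∈s b∈s ← elements (s , eq) =
  suc a , suc b , spans (a≢b ∘ Fin.suc-injective) (there a∈s) (there b∈s)

∈ᵖ-cases : ∀ {n} {u : Pair n} {a b x} → Spans u a b → x ∈ᵖ u → x ≡ a ⊎ x ≡ b
∈ᵖ-cases {u = s , eq} (spans a≢b a∈s b∈s) = ∣p∣≡2⇒x≡a⊎x≡b s eq a≢b a∈s b∈s

⊆-spanned : ∀ {n} {u v : Pair n} {a b x} → Spans u a b → a ∈ᵖ v → b ∈ᵖ v → x ∈ᵖ u → x ∈ᵖ v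
⊆-spanned u∋ab a∈v b∈v x∈u with ∈ᵖ-cases u∋ab x∈u
... | inj₁ refl = a∈v
... | inj₂ refl = b∈v

≡-spanned : ∀ {n} {u v : Pair n} {a b} → Spans u a b → Spans v a b → u ≡ v
≡-spanned {u = u} {v} u∋ab@(spans _ a∈u b∈u) v∋ab@(spans _ a∈v b∈v) =
  Pair-≡ (⊆-antisym (⊆-spanned {v = v} u∋ab a∈v b∈v) (⊆-spanned {v = u} v∋ab a∈u b∈u))

~-sym : ∀ {n} {u v : Pair n} → u ~ v → v ~ u
~-sym u~v = disjoint λ x∈v x∈u → ~⇒∉ u~v x∈u x∈v

~⇒≢ᵖ : ∀ {n} {u v : Pair n} {a c} → u ~ v → a ∈ᵖ u → c ∈ᵖ v → a ≢ c
~⇒≢ᵖ u~v a∈u c∈v refl = ~⇒∉ u~v a∈u c∈v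

~⇒≢ : ∀ {n} {u v : Pair n} → u ~ v → u ≢ v
~⇒≢ {u = u} u~v refl = let _ , _ , spans _ a∈u _ = elements u in ~⇒∉ u~v a∈u a∈u

~⇒Adj : ∀ {n} {u v : Pair n} → u ~ v → Adj (Kneser n 2) u v
~⇒Adj {u = u} {v} u~v (x , x∈u∩v) =
  let x∈u , x∈v = x∈p∩q⁻ (proj₁ u) (proj₁ v) x∈u∩v in ~⇒∉ u~v x∈u x∈v

Adj⇒~ : ∀ {n} {u v : Pair n} → Adj (Kneser n 2) u v → u ~ v
Adj⇒~ u~v = disjoint λ x∈u x∈v → u~v (_ , x∈p∩q⁺ (x∈u , x∈v))

_~?_ : ∀ {n} (u v : Pair n) → Dec (u ~ v)
u ~? v = map′ Adj⇒~ ~⇒Adj (¬? (nonempty? (proj₁ u ∩ proj₁ v)))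

record Meet {n} (u v : Pair n) : Set where
  constructor meet
  field
    {point} : Fin n
    ∈ˡ      : point ∈ᵖ u
    ∈ʳ      : point ∈ᵖ v

meet-sym : ∀ {n} {u v : Pair n} → Meet u v → Meet v u
meet-sym (meet x∈u x∈v) = meet x∈v x∈u

¬~⇒meet : ∀ {n} {u v : Pair n} → ¬ u ~ v → Meet u v
¬~⇒meet {u = u} {v} ¬u~v with nonempty? (proj₁ u ∩ proj₁ v)
... | yes (x , x∈u∩v) = let x∈u , x∈v = x∈p∩q⁻ (proj₁ u) (proj₁ v) x∈u∩v in meet x∈u x∈v
... | no u∩v-empty = ⊥-elim (¬u~v (Adj⇒~ u∩v-empty))

meet-other : ∀ {n} {r s : Pair n} {x y} → Meet r s → Spans s x y → x ∉ᵖ r → y ∈ᵖ r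
meet-other (meet z∈r z∈s) s∋xy x∉r with ∈ᵖ-cases s∋xy z∈s
... | inj₁ refl = ⊥-elim (x∉r z∈r)
... | inj₂ refl = z∈r

InjectiveOn : ∀ {A B : Set} → (A → B) → List A → Set
InjectiveOn f R = ∀ {x y} → x ∈ R → y ∈ R → f x ≡ f y → x ≡ y

unique⇒length≤ : ∀ {A : Set} {xs ys : List A} → Unique xs → xs ⊆ ys → length xs ≤ length ys
unique⇒length≤ {xs = []} _ _ = z≤n
unique⇒length≤ {xs = x ∷ xs} (x∉xs ∷ xs!) xs⊆ys
  with ys₁ , ys₂ , refl ← ∈-∃++ (xs⊆ys (here refl)) =
  ≤-trans (s≤s (unique⇒length≤ xs! xs⊆ys₁++ys₂)) (≤-reflexive (sym length-ys))
  where
  xs⊆ys₁++ys₂ : xs ⊆ ys₁ ++ ys₂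
  xs⊆ys₁++ys₂ {y} y∈xs with ∈-++⁻ ys₁ (xs⊆ys (there y∈xs))
  ... | inj₁ y∈ys₁ = ∈-++⁺ˡ y∈ys₁
  ... | inj₂ (here y≡x) = ⊥-elim (All.lookup x∉xs y∈xs (sym y≡x))
  ... | inj₂ (there y∈ys₂) = ∈-++⁺ʳ ys₁ y∈ys₂
  length-ys : length (ys₁ ++ x ∷ ys₂) ≡ suc (length (ys₁ ++ ys₂))
  length-ys = trans (length-++ ys₁)
                    (trans (+-suc (length ys₁) (length ys₂)) (cong suc (sym (length-++ ys₁))))

unique⇒length< : ∀ {A : Set} {xs ys : List A} {w} → Unique xs → xs ⊆ ys → w ∈ ys → w ∉ xs →
                 length xs <ℕ length ys
unique⇒length< {xs = xs} xs! xs⊆ys w∈ys w∉xs =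
  unique⇒length≤ (All.tabulate (λ x∈xs w≡x → w∉xs (subst (_∈ xs) (sym w≡x) x∈xs)) ∷ xs!) w∷xs⊆ys
  where
  w∷xs⊆ys : _ ∷ xs ⊆ _
  w∷xs⊆ys (here refl) = w∈ys
  w∷xs⊆ys (there x∈xs) = xs⊆ys x∈xs

map⁺-injectiveOn : ∀ {A B : Set} (f : A → B) {R : List A} →
                   Unique R → InjectiveOn f R → Unique (map f R)
map⁺-injectiveOn f {[]} _ _ = []
map⁺-injectiveOn f {x ∷ R} (x∉R ∷ R!) inj =
  All.tabulate fx∉ ∷ map⁺-injectiveOn f R! (λ y∈R z∈R → inj (there y∈R) (there z∈R))
  where
  fx∉ : ∀ {z} → z ∈ map f R → f x ≢ z
  fx∉ z∈fR fx≡z with y , y∈R , refl ← ∈-map⁻ f z∈fR =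
    All.lookup x∉R y∈R (inj (here refl) (there y∈R) fx≡z)

length-allFin : ∀ k → length (allFin k) ≡ k
length-allFin k = length-tabulate {n = k} (λ i → i)

length≤-injectiveOn : ∀ {A : Set} {k} (f : A → Fin k) {R : List A} →
                      Unique R → InjectiveOn f R → length R ≤ k
length≤-injectiveOn {k = k} f {R} R! inj =
  subst₂ _≤_ (length-map f R) (length-allFin k)
         (unique⇒length≤ (map⁺-injectiveOn f R! inj) (λ _ → ∈-allFin _))

length<-injectiveOn : ∀ {A : Set} {k} (f : A → Fin k) {R : List A} (w : Fin k) →
                      Unique R → InjectiveOn f R → (∀ {x} → x ∈ R → f x ≢ w) → length R <ℕ k
length<-injectiveOn {k = k} f {R} w R! inj missed =
  subst₂ _≤_ (cong suc (length-map f R)) (length-allFin k)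
         (unique⇒length< (map⁺-injectiveOn f R! inj) (λ _ → ∈-allFin _) (∈-allFin w) w∉fR)
  where
  w∉fR : w ∉ map f R
  w∉fR w∈fR with x , x∈R , w≡fx ← ∈-map⁻ f w∈fR = missed x∈R (sym w≡fx)

length-filter-∁ : ∀ {A : Set} {P : A → Set} (P? : ∀ x → Dec (P x)) (xs : List A) →
                  length xs ≡ length (filter P? xs) + length (filter (¬? ∘ P?) xs)
length-filter-∁ P? [] = refl
length-filter-∁ P? (x ∷ xs) with P? x
... | yes _ = cong suc (length-filter-∁ P? xs)
... | no _ = trans (cong suc (length-filter-∁ P? xs)) (sym (+-suc _ _))

module _ {n k : ℕ} (ends : Fin k → Fin n × Fin n) (class : Pair n → Fin k)
         {R : List (Pair n)} (R! : Unique R)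
         (classified : ∀ {r} → r ∈ R → uncurry (Spans r) (ends (class r))) where

  private
    class-injective : InjectiveOn class R
    class-injective {r} {r′} r∈R r′∈R eq =
      ≡-spanned (classified r∈R) (subst (λ i → uncurry (Spans r′) (ends i)) (sym eq) (classified r′∈R))

  length≤-classes : length R ≤ k
  length≤-classes = length≤-injectiveOn class R! class-injective

  length<-classes : (w : Fin k) → (∀ {r} → r ∈ R → ¬ uncurry (Spans r) (ends w)) → length R <ℕ k
  length<-classes w missed = length<-injectiveOn class w R! class-injective
    λ {r} r∈R eq → missed r∈R (subst (λ i → uncurry (Spans r) (ends i)) eq (classified r∈R))

lift : ∀ {n} → Pair n → Pair (suc n)
lift (s , eq) = false ∷ s , eq

pairWith0 : ∀ {n} → Fin n → Pair (suc n)
pairWith0 j = true ∷ ⁅ j ⁆ , cong suc (∣⁅x⁆∣≡1 j)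

pairs : (n : ℕ) → List (Pair n)
pairs zero = []
pairs (suc n) = map lift (pairs n) ++ map pairWith0 (allFin n)

lift-injective : ∀ {n} {u v : Pair n} → lift u ≡ lift v → u ≡ v
lift-injective = Pair-≡ ∘ cong (tail ∘ proj₁)

pairWith0-injective : ∀ {n} {i j : Fin n} → pairWith0 i ≡ pairWith0 j → i ≡ j
pairWith0-injective {i = i} {j} eq =
  x∈⁅y⁆⇒x≡y j (subst (i ∈ₛ_) (cong (tail ∘ proj₁) eq) (x∈⁅x⁆ i))

pairWith0∉lifts : ∀ {n} {s eq} {L : List (Pair n)} → (true ∷ s , eq) ∉ map lift L
pairWith0∉lifts v∈ with _ , _ , () ← ∈-map⁻ lift v∈

pairs-unique : ∀ n → Unique (pairs n)
pairs-unique zero = []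
pairs-unique (suc n) =
  Unique.++⁺ (Unique.map⁺ lift-injective (pairs-unique n))
             (Unique.map⁺ pairWith0-injective (Unique.allFin⁺ n))
             (λ (v∈lifts , v∈with0) → let j , _ , v≡ = ∈-map⁻ pairWith0 v∈with0 in
                                      pairWith0∉lifts (subst (_∈ _) v≡ v∈lifts))

∈-pairs : ∀ n (v : Pair n) → v ∈ pairs n
∈-pairs (suc n) (false ∷ s , eq) = ∈-++⁺ˡ (∈-map⁺ lift (∈-pairs n (s , eq)))
∈-pairs (suc n) (true ∷ s , eq) with j , refl ← ∣p∣≡1⇒p≡⁅x⁆ s (cong pred eq) =
  ∈-++⁺ʳ (map lift (pairs n))
         (subst (_∈ map pairWith0 (allFin n)) (Pair-≡ refl) (∈-map⁺ pairWith0 (∈-allFin j)))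

C2-suc : ∀ n → suc n C 2 ≡ n + n C 2
C2-suc n = trans (sym (nCk+nC[k+1]≡[n+1]C[k+1] n 1)) (cong (_+ n C 2) (nC1≡n n))

C2≥1 : ∀ k → 1 ≤ suc (suc k) C 2
C2≥1 k = subst (1 ≤_) (sym (C2-suc (suc k))) (s≤s z≤n)

suc-∸1 : ∀ {m} → 1 ≤ m → suc (m ∸ 1) ≡ m
suc-∸1 {suc m} _ = refl

length-pairs : ∀ n → length (pairs n) ≡ n C 2
length-pairs zero = refl
length-pairs (suc n) = begin
  length (map lift (pairs n) ++ map pairWith0 (allFin n))
    ≡⟨ length-++ (map lift (pairs n)) ⟩
  length (map lift (pairs n)) + length (map pairWith0 (allFin n))
    ≡⟨ cong₂ _+_ (length-map lift (pairs n)) (length-map pairWith0 (allFin n)) ⟩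
  length (pairs n) + length (allFin n)
    ≡⟨ cong₂ _+_ (length-pairs n) (length-allFin n) ⟩
  n C 2 + n
    ≡⟨ +-comm (n C 2) n ⟩
  n + n C 2
    ≡⟨ C2-suc n ⟨
  suc n C 2 ∎
  where open ≡-Reasoning

Below : ∀ {n} (a b c d : Fin n) → Set
Below a b c d = a < c × a < d × b < c × b < d

Split : ∀ {n} (a b c d : Fin n) → Set
Split a b c d = Below a b c d ⊎ Below c d a b

Splitting : ∀ {n} (a b c d : Fin n) → Set
Splitting a b c d = Split a b c d ⊎ Split a c b d ⊎ Split a d b c

Split-swapˡ : ∀ {n} {a b c d : Fin n} → Split a b c d → Split b a c d
Split-swapˡ (inj₁ (a<c , a<d , b<c , b<d)) = inj₁ (b<c , b<d , a<c , a<d)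
Split-swapˡ (inj₂ (c<a , c<b , d<a , d<b)) = inj₂ (c<b , c<a , d<b , d<a)

Split-swapʳ : ∀ {n} {a b c d : Fin n} → Split a b c d → Split a b d c
Split-swapʳ (inj₁ (a<c , a<d , b<c , b<d)) = inj₁ (a<d , a<c , b<d , b<c)
Split-swapʳ (inj₂ (c<a , c<b , d<a , d<b)) = inj₂ (d<a , d<b , c<a , c<b)

Split-comm : ∀ {n} {a b c d : Fin n} → Split a b c d → Split c d a b
Split-comm (inj₁ below) = inj₂ below
Split-comm (inj₂ above) = inj₁ above

Splitting-swapˡ : ∀ {n} {a b c d : Fin n} → Splitting b a c d → Splitting a b c d
Splitting-swapˡ (inj₁ s) = inj₁ (Split-swapˡ s)
Splitting-swapˡ (inj₂ (inj₁ s)) = inj₂ (inj₂ (Split-comm s))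
Splitting-swapˡ (inj₂ (inj₂ s)) = inj₂ (inj₁ (Split-comm s))

Splitting-swapʳ : ∀ {n} {a b c d : Fin n} → Splitting a b d c → Splitting a b c d
Splitting-swapʳ (inj₁ s) = inj₁ (Split-swapʳ s)
Splitting-swapʳ (inj₂ (inj₁ s)) = inj₂ (inj₂ s)
Splitting-swapʳ (inj₂ (inj₂ s)) = inj₂ (inj₁ s)

Splitting-comm : ∀ {n} {a b c d : Fin n} → Splitting c d a b → Splitting a b c d
Splitting-comm (inj₁ s) = inj₁ (Split-comm s)
Splitting-comm (inj₂ (inj₁ s)) = inj₂ (inj₁ (Split-swapʳ (Split-swapˡ s)))
Splitting-comm (inj₂ (inj₂ s)) = inj₂ (inj₂ (Split-swapʳ (Split-swapˡ (Split-comm s))))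

splitting-sorted : ∀ {n} {a b c d : Fin n} → a < b → c < d → a < c → b ≢ c → Splitting a b c d
splitting-sorted {b = b} {c} a<b c<d a<c b≢c with Fin.<-cmp b c
... | tri< b<c _ _ = inj₁ (inj₁ (a<c , Fin.<-trans a<c c<d , b<c , Fin.<-trans b<c c<d))
... | tri≈ _ b≡c _ = ⊥-elim (b≢c b≡c)
... | tri> _ _ c<b = inj₂ (inj₁ (inj₁ (a<b , Fin.<-trans a<c c<d , c<b , c<d)))

splitting-ordered : ∀ {n} {a b c d : Fin n} → a < b → c < d →
                    a ≢ c → a ≢ d → b ≢ c → b ≢ d → Splitting a b c d
splitting-ordered {a = a} {c = c} a<b c<d a≢c a≢d b≢c b≢d with Fin.<-cmp a c
... | tri< a<c _ _ = splitting-sorted a<b c<d a<c b≢c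
... | tri≈ _ a≡c _ = ⊥-elim (a≢c a≡c)
... | tri> _ _ c<a = Splitting-comm (splitting-sorted c<d a<b c<a (≢-sym a≢d))

splitting : ∀ {n} {a b c d : Fin n} → a ≢ b → c ≢ d →
            a ≢ c → a ≢ d → b ≢ c → b ≢ d → Splitting a b c d
splitting {a = a} {b} {c} {d} a≢b c≢d a≢c a≢d b≢c b≢d with Fin.<-cmp a b | Fin.<-cmp c d
... | tri≈ _ a≡b _ | _ = ⊥-elim (a≢b a≡b)
... | _ | tri≈ _ c≡d _ = ⊥-elim (c≢d c≡d)
... | tri< a<b _ _ | tri< c<d _ _ = splitting-ordered a<b c<d a≢c a≢d b≢c b≢d
... | tri< a<b _ _ | tri> _ _ d<c = Splitting-swapʳ (splitting-ordered a<b d<c a≢d a≢c b≢d b≢c)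
... | tri> _ _ b<a | tri< c<d _ _ = Splitting-swapˡ (splitting-ordered b<a c<d b≢c b≢d a≢c a≢d)
... | tri> _ _ b<a | tri> _ _ d<c =
  Splitting-swapˡ (Splitting-swapʳ (splitting-ordered b<a d<c b≢d b≢c a≢d a≢c))

-- A bramble of Kneser(n,2)

_≺_ : ∀ {n} → Pair n → Pair n → Set
u ≺ v = ∀ {i j} → i ∈ᵖ u → j ∈ᵖ v → i < j

_≺?_ : ∀ {n} (u v : Pair n) → Dec (u ≺ v)
u ≺? v = map′ (λ h {i} {j} → h i j) (λ h i j → h)
  (Fin.all? λ i → Fin.all? λ j → (i ∈? proj₁ u) →-dec ((j ∈? proj₁ v) →-dec (i Fin.<? j)))

Below⇒≺ : ∀ {n} {u v : Pair n} {a b c d} → Spans u a b → Spans v c d → Below a b c d → u ≺ v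
Below⇒≺ u∋ab v∋cd (a<c , a<d , b<c , b<d) i∈u j∈v with ∈ᵖ-cases u∋ab i∈u | ∈ᵖ-cases v∋cd j∈v
... | inj₁ refl | inj₁ refl = a<c
... | inj₁ refl | inj₂ refl = a<d
... | inj₂ refl | inj₁ refl = b<c
... | inj₂ refl | inj₂ refl = b<d

spanned-~ : ∀ {n} {u v : Pair n} {a b c d} → Spans u a b → Spans v c d →
            a ≢ c → a ≢ d → b ≢ c → b ≢ d → u ~ v
spanned-~ u∋ab v∋cd a≢c a≢d b≢c b≢d =
  disjoint λ x∈u x∈v → distinct (∈ᵖ-cases u∋ab x∈u) (∈ᵖ-cases v∋cd x∈v)
  where
  distinct : ∀ {x} → x ≡ _ ⊎ x ≡ _ → x ≡ _ ⊎ x ≡ _ → ⊥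
  distinct (inj₁ refl) (inj₁ refl) = a≢c refl
  distinct (inj₁ refl) (inj₂ refl) = a≢d refl
  distinct (inj₂ refl) (inj₁ refl) = b≢c refl
  distinct (inj₂ refl) (inj₂ refl) = b≢d refl

data BrambleElement (n : ℕ) : Set where
  path  : (x y z : Pair n) → x ~ y → y ~ z → x ≢ z → BrambleElement n
  split : (p q : Pair n) → p ~ q → p ≺ q → BrambleElement n

vertices : ∀ {n} → BrambleElement n → List (Pair n)
vertices (path x y z _ _ _) = x ∷ y ∷ z ∷ []
vertices (split p q _ _) = p ∷ q ∷ []

data Linked {n} : List (Pair n) → Set where
  end  : ∀ {v} → Linked (v ∷ [])
  link : ∀ {v w vs} → v ~ w → Linked (w ∷ vs) → Linked (v ∷ w ∷ vs)

linked : ∀ {n} (b : BrambleElement n) → Linked (vertices b)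
linked (path _ _ _ x~y y~z _) = link x~y (link y~z end)
linked (split _ _ p~q _) = link p~q end

first-edge : ∀ {n} (b : BrambleElement n) →
             ∃ λ r₁ → ∃ λ r₂ → r₁ ∈ vertices b × r₂ ∈ vertices b × r₁ ~ r₂
first-edge (path x y _ x~y _ _) = x , y , here refl , there (here refl) , x~y
first-edge (split p q p~q _) = p , q , here refl , there (here refl) , p~q

meet-path-ends : ∀ {n} {x y z r : Pair n} → x ~ y → y ~ z → Meet r x → Meet r y → Meet r z →
                 ∃ λ e → e ∈ᵖ r × e ∈ᵖ x × e ∈ᵖ z
meet-path-ends {r = r} x~y y~z (meet e∈r e∈x) (meet f∈r f∈y) (meet g∈r g∈z)
  with ∈ᵖ-cases (spans {u = r} (~⇒≢ᵖ x~y e∈x f∈y) e∈r f∈r) g∈r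
... | inj₁ refl = _ , e∈r , e∈x , g∈z
... | inj₂ refl = ⊥-elim (~⇒∉ y~z f∈y g∈z)

path-edge-¬meet : ∀ {n} {x y z r₁ r₂ : Pair n} → x ~ y → y ~ z → x ≢ z → r₁ ~ r₂ →
                  All (Meet r₁) (x ∷ y ∷ z ∷ []) → All (Meet r₂) (x ∷ y ∷ z ∷ []) → ⊥
path-edge-¬meet x~y y~z x≢z r₁~r₂ (r₁x ∷ r₁y ∷ r₁z ∷ []) (r₂x ∷ r₂y ∷ r₂z ∷ [])
  with e , e∈r₁ , e∈x , e∈z ← meet-path-ends x~y y~z r₁x r₁y r₁z
     | e′ , e′∈r₂ , e′∈x , e′∈z ← meet-path-ends x~y y~z r₂x r₂y r₂z =
  let e≢e′ = ~⇒≢ᵖ r₁~r₂ e∈r₁ e′∈r₂ in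
  x≢z (≡-spanned (spans e≢e′ e∈x e′∈x) (spans e≢e′ e∈z e′∈z))

split-split-¬meet : ∀ {n} {p q r₁ r₂ : Pair n} → p ≺ q → r₁ ≺ r₂ → Meet r₁ q → Meet r₂ p → ⊥
split-split-¬meet p≺q r₁≺r₂ (meet f∈r₁ f∈q) (meet e∈r₂ e∈p) =
  Fin.<-asym (p≺q e∈p f∈q) (r₁≺r₂ f∈r₁ e∈r₂)

¬all-meet : ∀ {n} (b₁ b₂ : BrambleElement n) →
            ¬ (∀ {u v} → u ∈ vertices b₁ → v ∈ vertices b₂ → Meet u v)
¬all-meet (path x y z x~y y~z x≢z) b₂ all-meet =
  let r₁ , r₂ , r₁∈ , r₂∈ , r₁~r₂ = first-edge b₂ in
  path-edge-¬meet x~y y~z x≢z r₁~r₂ (All.tabulate λ u∈ → meet-sym (all-meet u∈ r₁∈))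
                                    (All.tabulate λ u∈ → meet-sym (all-meet u∈ r₂∈))
¬all-meet (split p q p~q _) (path x y z x~y y~z x≢z) all-meet =
  path-edge-¬meet x~y y~z x≢z p~q (All.tabulate (all-meet (here refl)))
                                  (All.tabulate (all-meet (there (here refl))))
¬all-meet (split p q _ p≺q) (split r₁ r₂ _ r₁≺r₂) all-meet =
  split-split-¬meet p≺q r₁≺r₂ (meet-sym (all-meet (there (here refl)) (here refl)))
                              (meet-sym (all-meet (here refl) (there (here refl))))

touching : ∀ {n} (b₁ b₂ : BrambleElement n) →
           ∃ λ u → ∃ λ v → u ∈ vertices b₁ × v ∈ vertices b₂ × u ~ v
touching b₁ b₂ with any? (λ u → any? (u ~?_) (vertices b₂)) (vertices b₁)
... | yes found =
  let u , u∈ , found-v = find found ; v , v∈ , u~v = find found-v in u , v , u∈ , v∈ , u~v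
... | no none =
  ⊥-elim (¬all-meet b₁ b₂ λ u∈ v∈ → ¬~⇒meet λ u~v → none (lose u∈ (lose v∈ u~v)))

-- Large sets of pairs contain a bramble element

other : ∀ {n} → Fin n → Pair n → Fin n
other a r with x , y , _ ← elements r with x Fin.≟ a
... | yes _ = y
... | no _ = x

other-spans : ∀ {n} {a} {r : Pair n} → a ∈ᵖ r → Spans r a (other a r)
other-spans {a = a} {r} a∈r with x , y , spans x≢y x∈r y∈r ← elements r with x Fin.≟ a
... | yes refl = spans x≢y x∈r y∈r
... | no x≢a = spans (≢-sym x≢a) a∈r x∈r

star-bound : ∀ {n} {R : List (Pair n)} {a} → Unique R → (∀ {r} → r ∈ R → a ∈ᵖ r) → length R <ℕ n
star-bound {a = a} R! a∈ =
  length<-classes (a ,_) (other a) R! (other-spans ∘ a∈) a λ _ a∋a → Spans.distinct a∋a refl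

triangle-bound : ∀ {n} {R : List (Pair n)} {r₁ r₂ p : Pair n} {a b h} → Unique R →
                 (∀ {r s} → r ∈ R → s ∈ R → Meet r s) → r₁ ∈ R → r₂ ∈ R → p ∈ R →
                 Spans p a b → Spans r₁ b h → Spans r₂ a h → length R ≤ 3
triangle-bound {a = a} {b} {h} R! meets r₁∈ r₂∈ p∈ p∋ab r₁∋bh r₂∋ah =
  length≤-classes ends class R! classified
  where
  ends : Fin 3 → _
  ends = lookup ((b , h) ∷ (a , h) ∷ (a , b) ∷ [])
  class : Pair _ → Fin 3
  class r with a ∈? proj₁ r | b ∈? proj₁ r
  ... | no _ | _ = # 0
  ... | yes _ | no _ = # 1
  ... | yes _ | yes _ = # 2
  classified : ∀ {r} → r ∈ _ → uncurry (Spans r) (ends (class r))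
  classified {r} r∈ with a ∈? proj₁ r | b ∈? proj₁ r
  ... | no a∉r | _ = spans (Spans.distinct r₁∋bh) (meet-other (meets r∈ p∈) p∋ab a∉r)
                                                  (meet-other (meets r∈ r₂∈) r₂∋ah a∉r)
  ... | yes a∈r | no b∉r = spans (Spans.distinct r₂∋ah) a∈r (meet-other (meets r∈ r₁∈) r₁∋bh b∉r)
  ... | yes a∈r | yes b∈r = spans (Spans.distinct p∋ab) a∈r b∈r

intersecting-bound : ∀ {n} {R : List (Pair n)} → Unique R → (∀ {r s} → r ∈ R → s ∈ R → Meet r s) →
                     length R <ℕ n ⊎ length R ≤ 3
intersecting-bound {R = []} _ _ = inj₂ z≤n
intersecting-bound {R = p ∷ R′} R! meets with a , b , p∋ab ← elements p
  with All.all? (λ r → a ∈? proj₁ r) (p ∷ R′) | All.all? (λ r → b ∈? proj₁ r) (p ∷ R′)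
... | yes all-a | _ = inj₁ (star-bound R! (All.lookup all-a))
... | no _ | yes all-b = inj₁ (star-bound R! (All.lookup all-b))
... | no not-all-a | no not-all-b
  with r₁ , r₁∈ , a∉r₁ ← find (¬All⇒Any¬ (λ r → a ∈? proj₁ r) (p ∷ R′) not-all-a)
     | r₂ , r₂∈ , b∉r₂ ← find (¬All⇒Any¬ (λ r → b ∈? proj₁ r) (p ∷ R′) not-all-b)
  with meet h∈r₁ h∈r₂ ← meets r₁∈ r₂∈ =
  inj₂ (triangle-bound R! meets r₁∈ r₂∈ (here refl) p∋ab r₁∋bh r₂∋ah)
  where
  r₁∋bh = spans (λ { refl → b∉r₂ h∈r₂ }) (meet-other (meets r₁∈ (here refl)) p∋ab a∉r₁) h∈r₁
  r₂∋ah = spans (λ { refl → a∉r₁ h∈r₁ })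
                (meet-other (meets r₂∈ (here refl)) (Spans-swap p∋ab) b∉r₂) h∈r₂

record BrambleFree {n} (R : List (Pair n)) : Set where
  field
    no-path  : ∀ {x y z} → x ∈ R → y ∈ R → z ∈ R → x ~ y → y ~ z → x ≢ z → ⊥
    no-split : ∀ {p q} → p ∈ R → q ∈ R → p ~ q → p ≺ q → ⊥

  no-split-pairs : ∀ {w x y z} → w ≢ y → w ≢ z → x ≢ y → x ≢ z → Split w x y z →
                   (∀ {u} → u ∈ R → ¬ Spans u w x) ⊎ (∀ {v} → v ∈ R → ¬ Spans v y z)
  no-split-pairs {w} {x} {y} {z} w≢y w≢z x≢y x≢z wx|yz
    with any? (λ u → Spans? u w x) R | any? (λ v → Spans? v y z) R
  ... | no none | _ = inj₁ λ u∈ u∋wx → none (lose u∈ u∋wx)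
  ... | yes _ | no none = inj₂ λ v∈ v∋yz → none (lose v∈ v∋yz)
  ... | yes found-u | yes found-v
    with u , u∈ , u∋wx ← find found-u | v , v∈ , v∋yz ← find found-v
    with spanned-~ u∋wx v∋yz w≢y w≢z x≢y x≢z | wx|yz
  ... | u~v | inj₁ below = ⊥-elim (no-split u∈ v∈ u~v (Below⇒≺ u∋wx v∋yz below))
  ... | u~v | inj₂ above = ⊥-elim (no-split v∈ u∈ (~-sym u~v) (Below⇒≺ v∋yz u∋wx above))

open BrambleFree

-- Every other member of R meets both p and q, so R consists of pairs inside p ∪ q; and
-- however {a,b,c,d} splits into a lower and an upper pair, R misses one of these six.
edge-bound : ∀ {n} {R : List (Pair n)} {p q : Pair n} → Unique R → BrambleFree R →
             p ∈ R → q ∈ R → p ~ q → length R <ℕ 6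
edge-bound {R = R} {p} {q} R! free p∈ q∈ p~q
  with a , b , p∋ab@(spans a≢b a∈p b∈p) ← elements p
     | c , d , q∋cd@(spans c≢d c∈q d∈q) ← elements q =
  by-splitting (splitting a≢b c≢d a≢c a≢d b≢c b≢d)
  where
  a≢c = ~⇒≢ᵖ p~q a∈p c∈q
  a≢d = ~⇒≢ᵖ p~q a∈p d∈q
  b≢c = ~⇒≢ᵖ p~q b∈p c∈q
  b≢d = ~⇒≢ᵖ p~q b∈p d∈q

  ends : Fin 6 → _
  ends = lookup ((a , b) ∷ (c , d) ∷ (a , c) ∷ (a , d) ∷ (b , c) ∷ (b , d) ∷ [])

  class : Pair _ → Fin 6
  class r with a ∈? proj₁ r | b ∈? proj₁ r | c ∈? proj₁ r
  ... | yes _ | yes _ | _ = # 0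
  ... | no _ | no _ | _ = # 1
  ... | yes _ | no _ | yes _ = # 2
  ... | yes _ | no _ | no _ = # 3
  ... | no _ | yes _ | yes _ = # 4
  ... | no _ | yes _ | no _ = # 5

  meets-q : ∀ {r} → r ∈ R → r ≢ p → Meet r q
  meets-q r∈ r≢p = ¬~⇒meet λ r~q → no-path free p∈ q∈ r∈ p~q (~-sym r~q) (≢-sym r≢p)

  classified : ∀ {r} → r ∈ R → uncurry (Spans r) (ends (class r))
  classified {r} r∈ with a ∈? proj₁ r | b ∈? proj₁ r | c ∈? proj₁ r
  ... | yes a∈r | yes b∈r | _ = spans a≢b a∈r b∈r
  ... | no a∉r | no b∉r | _ with r ≟ᵖ q
  ...   | yes refl = q∋cd
  ...   | no r≢q = ⊥-elim (no-path free r∈ p∈ q∈ (disjoint r∉p) p~q r≢q)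
    where
    r∉p : ∀ {x} → x ∈ᵖ r → x ∉ᵖ p
    r∉p x∈r x∈p with ∈ᵖ-cases p∋ab x∈p
    ... | inj₁ refl = a∉r x∈r
    ... | inj₂ refl = b∉r x∈r
  classified {r} r∈ | yes a∈r | no b∉r | yes c∈r = spans a≢c a∈r c∈r
  classified {r} r∈ | yes a∈r | no b∉r | no c∉r =
    spans a≢d a∈r (meet-other (meets-q r∈ λ { refl → b∉r b∈p }) q∋cd c∉r)
  classified {r} r∈ | no a∉r | yes b∈r | yes c∈r = spans b≢c b∈r c∈r
  classified {r} r∈ | no a∉r | yes b∈r | no c∉r =
    spans b≢d b∈r (meet-other (meets-q r∈ λ { refl → a∉r a∈p }) q∋cd c∉r)

  missing : ∀ i j → (∀ {u} → u ∈ R → ¬ uncurry (Spans u) (ends i))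
                  ⊎ (∀ {v} → v ∈ R → ¬ uncurry (Spans v) (ends j)) → length R <ℕ 6
  missing i j = [ length<-classes ends class R! classified i , length<-classes ends class R! classified j ]′

  by-splitting : Splitting a b c d → length R <ℕ 6
  by-splitting (inj₁ (inj₁ below)) = ⊥-elim (no-split free p∈ q∈ p~q (Below⇒≺ p∋ab q∋cd below))
  by-splitting (inj₁ (inj₂ above)) = ⊥-elim (no-split free q∈ p∈ (~-sym p~q) (Below⇒≺ q∋cd p∋ab above))
  by-splitting (inj₂ (inj₁ ac|bd)) =
    missing (# 2) (# 5) (no-split-pairs free a≢b a≢d (≢-sym b≢c) c≢d ac|bd)
  by-splitting (inj₂ (inj₂ ad|bc)) =
    missing (# 3) (# 4) (no-split-pairs free a≢b a≢c (≢-sym b≢d) (≢-sym c≢d) ad|bc)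

bramble-free-bound : ∀ {n} {R : List (Pair n)} → Unique R → BrambleFree R →
                     length R <ℕ 6 ⊎ length R <ℕ n
bramble-free-bound {R = R} R! free with any? (λ p → any? (p ~?_) R) R
... | yes found =
  let p , p∈ , found-q = find found ; q , q∈ , p~q = find found-q in
  inj₁ (edge-bound R! free p∈ q∈ p~q)
... | no none with intersecting-bound R! (λ r∈ s∈ → ¬~⇒meet λ r~s → none (lose r∈ (lose s∈ r~s)))
...   | inj₁ ∣R∣<n = inj₂ ∣R∣<n
...   | inj₂ ∣R∣≤3 = inj₁ (≤-trans (s≤s ∣R∣≤3) (s≤s (s≤s (s≤s (s≤s z≤n)))))

bramble-element-in : ∀ {n} (R : List (Pair n)) → Unique R → 6 ≤ length R → n ≤ length R →
                     ∃ λ b → All (_∈ R) (vertices b)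
bramble-element-in R R! 6≤∣R∣ n≤∣R∣
  with any? (λ x → any? (λ y → any? (λ z → x ~? y ×-dec y ~? z ×-dec ¬? (x ≟ᵖ z)) R) R) R
... | yes found =
  let x , x∈ , found-y = find found ; y , y∈ , found-z = find found-y
      z , z∈ , x~y , y~z , x≢z = find found-z
  in path x y z x~y y~z x≢z , x∈ ∷ y∈ ∷ z∈ ∷ []
... | no no-path with any? (λ p → any? (λ q → p ~? q ×-dec p ≺? q) R) R
...   | yes found =
  let p , p∈ , found-q = find found ; q , q∈ , p~q , p≺q = find found-q in
  split p q p~q p≺q , p∈ ∷ q∈ ∷ []
...   | no no-split = ⊥-elim ([ ≤⇒≯ 6≤∣R∣ , ≤⇒≯ n≤∣R∣ ]′ (bramble-free-bound R! free))
  where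
  free : BrambleFree R
  free = record
    { no-path  = λ x∈ y∈ z∈ x~y y~z x≢z → no-path (lose x∈ (lose y∈ (lose z∈ (x~y , y~z , x≢z))))
    ; no-split = λ p∈ q∈ p~q p≺q → no-split (lose p∈ (lose q∈ (p~q , p≺q))) }

_++ʷ_ : ∀ {T S a b c} → WalkIn T S a b → WalkIn T S b c → WalkIn T S a c
here _ ++ʷ w′ = w′
step s e w ++ʷ w′ = step s e (w ++ʷ w′)

walk-start : ∀ {T S a b} → WalkIn T S a b → S a
walk-start (here s) = s
walk-start (step s _ _) = s

TEdge-sym : ∀ {T x y} → TEdge T x y → TEdge T y x
TEdge-sym (inj₁ e) = inj₂ e
TEdge-sym (inj₂ e) = inj₁ e

reverseʷ : ∀ {T S a b} → WalkIn T S a b → WalkIn T S b a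
reverseʷ (here s) = here s
reverseʷ {T} (step s e w) = reverseʷ w ++ʷ step (walk-start w) (TEdge-sym {T} e) (here s)

WalkIn-map : ∀ {T} {S S′ : Node T → Set} → (∀ {y} → S y → S′ y) →
             ∀ {a b} → WalkIn T S a b → WalkIn T S′ a b
WalkIn-map f (here s) = here (f s)
WalkIn-map f (step s e w) = step (f s) e (WalkIn-map f w)

data Descendant (T : Tree) (c : Node T) : Node T → Set where
  self : Descendant T c c
  down : ∀ {i} → Descendant T c (parent T i) → Descendant T c (suc i)

descendant-of-root : ∀ T (y : Node T) → Descendant T zero y
descendant-of-root T y = go (suc (m T)) y (Fin.toℕ<n y)
  where
  go : ∀ k (y : Node T) → toℕ y <ℕ k → Descendant T zero y
  go _ zero _ = self
  go (suc k) (suc i) (s≤s i<k) = down (go k (parent T i) (≤-<-trans (parent< T i) i<k))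

descendant-child : ∀ {T x y} → Descendant T x y → y ≢ x →
                   ∃ λ i → parent T i ≡ x × Descendant T (suc i) y
descendant-child self y≢x = ⊥-elim (y≢x refl)
descendant-child {T} {x} (down {i} d) _ with parent T i Fin.≟ x
... | yes pi≡x = i , pi≡x , self
... | no pi≢x with j , pj≡x , d′ ← descendant-child d pi≢x = j , pj≡x , down d′

Exit : (T : Tree) → Node T → Node T → Node T → Set
Exit T c y z = y ≡ c × ∃ λ i → c ≡ suc i × z ≡ parent T i

step-descendant : ∀ {T c y z} → Descendant T c y → TEdge T y z → Descendant T c z ⊎ Exit T c y z
step-descendant d (inj₂ (i , refl , refl)) = inj₁ (down d)
step-descendant d (inj₁ (i , refl , refl)) with d
... | self = inj₂ (refl , i , refl , refl)
... | down d′ = inj₁ d′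

walk-descendant : ∀ {T S c a b} → (∀ {y z} → S y → S z → ¬ Exit T c y z) →
                  WalkIn T S a b → Descendant T c a → Descendant T c b
walk-descendant no-exit (here _) d = d
walk-descendant no-exit (step s e w) d with step-descendant d e
... | inj₁ d′ = walk-descendant no-exit w d′
... | inj₂ exit = ⊥-elim (no-exit s (walk-start w) exit)

-- The Helly property of subtrees, by descent from the root: if S x lies below x, it lies
-- below a child c of x (it is connected and avoids x), and then so does S c, which meets S x.
no-avoiding-intersecting-subtrees :
  (T : Tree) (S : Node T → Node T → Set) → (∀ x → ConnectedNonempty T (S x)) → (∀ x → ¬ S x x) →
  (∀ x y → ∃ λ w → S x w × S y w) → ⊥
no-avoiding-intersecting-subtrees T S connected avoids intersect =
  descend (suc (m T)) zero ≤-refl (λ y _ → descendant-of-root T y)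
  where
  descend : (fuel : ℕ) (x : Node T) → m T <ℕ toℕ x + fuel → (∀ y → S x y → Descendant T x y) → ⊥
  descend zero x m<x+0 _ = ≤⇒≯ (≤-pred (Fin.toℕ<n x)) (subst (m T <ℕ_) (+-identityʳ (toℕ x)) m<x+0)
  descend (suc fuel) x m<x+fuel Sx-below-x
    with y₀ , y₀∈Sx ← proj₁ (connected x)
    with i , refl , y₀-below-c ← descendant-child (Sx-below-x y₀ y₀∈Sx) (λ { refl → avoids x y₀∈Sx })
    with w , w∈Sx , w∈Sc ← intersect (parent T i) (suc i) =
    descend fuel (suc i) m<c+fuel Sc-below-c
    where
    Sx-below-c : ∀ y → S (parent T i) y → Descendant T (suc i) y
    Sx-below-c y y∈Sx = walk-descendant (λ { _ z∈Sx (_ , _ , refl , refl) → avoids _ z∈Sx })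
                                        (proj₂ (connected _) y₀ y y₀∈Sx y∈Sx) y₀-below-c
    Sc-below-c : ∀ y → S (suc i) y → Descendant T (suc i) y
    Sc-below-c y y∈Sc = walk-descendant (λ { y∈Sc′ _ (refl , _) → avoids _ y∈Sc′ })
                                        (proj₂ (connected _) w y w∈Sc y∈Sc) (Sx-below-c w w∈Sx)
    m<c+fuel : m T <ℕ suc (toℕ i) + fuel
    m<c+fuel = ≤-trans m<x+fuel (≤-trans (≤-reflexive (+-suc _ fuel)) (s≤s (+-monoˡ-≤ fuel (parent< T i))))

module _ {n : ℕ} (D : TreeDecomposition (Kneser n 2)) where

  open import Data.List.Membership.DecPropositional (_≟ᵖ_ {n}) using () renaming (_∈?_ to _∈ᴸ?_)

  Touches : List (Pair n) → Node (tree D) → Set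
  Touches vs x = ∃ λ v → v ∈ vs × v ∈ bag D x

  private
    hub : ∀ {vs} → Linked vs →
          ∃ λ e → Touches vs e × ∀ y → Touches vs y → WalkIn (tree D) (Touches vs) y e
    hub {v ∷ []} end =
      let e , v∈e = proj₁ (vertexOK D v) in
      e , (v , here refl , v∈e) ,
      λ { y (_ , here refl , v∈y) →
            WalkIn-map (λ v∈ → v , here refl , v∈) (proj₂ (vertexOK D v) y e v∈y v∈e) }
    hub {v ∷ w ∷ vs} (link v~w rest) with e , v∈e , w∈e ← edgeOK D v w (~⇒Adj v~w) =
      e , (v , here refl , v∈e) , to-e
      where
      to-e′ = proj₂ (proj₂ (hub rest))
      to-e : ∀ y → Touches (v ∷ w ∷ vs) y → WalkIn (tree D) (Touches (v ∷ w ∷ vs)) y e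
      to-e y (_ , here refl , v∈y) =
        WalkIn-map (λ v∈ → v , here refl , v∈) (proj₂ (vertexOK D v) y e v∈y v∈e)
      to-e y (u , there u∈ , u∈y) =
        WalkIn-map (λ (u , u∈ , u∈x) → u , there u∈ , u∈x)
                   (to-e′ y (u , u∈ , u∈y) ++ʷ reverseʷ (to-e′ e (w , here refl , w∈e)))

  touches-connected : ∀ {vs} → Linked vs → ConnectedNonempty (tree D) (Touches vs)
  touches-connected l =
    let e , e∈ , to-e = hub l in (e , e∈) , λ x y x∈ y∈ → to-e x x∈ ++ʷ reverseʷ (to-e y y∈)

  ¬bramble-avoiding-bags : (β : Node (tree D) → BrambleElement n) →
                           ¬ (∀ x → All (_∉ bag D x) (vertices (β x)))
  ¬bramble-avoiding-bags β avoiding =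
    no-avoiding-intersecting-subtrees (tree D) (λ x → Touches (vertices (β x)))
      (λ x → touches-connected (linked (β x)))
      (λ x (v , v∈ , v∈x) → All.lookup (avoiding x) v∈ v∈x)
      λ x y → let u , v , u∈ , v∈ , u~v = touching (β x) (β y)
                  w , u∈w , v∈w = edgeOK D u v (~⇒Adj u~v)
              in w , (u , u∈ , u∈w) , (v , v∈ , v∈w)

  outside : Node (tree D) → List (Pair n)
  outside x = filter (λ v → ¬? (v ∈ᴸ? bag D x)) (pairs n)

  C2≤outside+bag : ∀ x → n C 2 ≤ length (outside x) + length (bag D x)
  C2≤outside+bag x = begin
    n C 2                                                          ≡⟨ length-pairs n ⟨
    length (pairs n)                                               ≡⟨ length-filter-∁ (_∈ᴸ? bag D x) (pairs n) ⟩
    length (filter (_∈ᴸ? bag D x) (pairs n)) + length (outside x)  ≤⟨ +-monoˡ-≤ _ inside≤bag ⟩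
    length (bag D x) + length (outside x)                          ≡⟨ +-comm (length (bag D x)) _ ⟩
    length (outside x) + length (bag D x)                          ∎
    where
    open ≤-Reasoning
    inside≤bag : length (filter (_∈ᴸ? bag D x) (pairs n)) ≤ length (bag D x)
    inside≤bag = unique⇒length≤ (Unique.filter⁺ (_∈ᴸ? bag D x) (pairs-unique n))
                                (λ v∈ → proj₂ (∈-filter⁻ (_∈ᴸ? bag D x) {xs = pairs n} v∈))

  ¬bags≤ : (B : ℕ) → (∀ x → length (bag D x) ≤ B) → 6 + B ≤ n C 2 → n + B ≤ n C 2 → ⊥
  ¬bags≤ B bags≤B 6+B≤ n+B≤ = ¬bramble-avoiding-bags (proj₁ ∘ found) λ x →
    All.map (λ v∈ → proj₂ (∈-filter⁻ (λ v → ¬? (v ∈ᴸ? bag D x)) {xs = pairs n} v∈)) (proj₂ (found x))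
    where
    large : ∀ k x → k + B ≤ n C 2 → k ≤ length (outside x)
    large k x k+B≤ =
      +-cancelʳ-≤ B k _ (≤-trans k+B≤ (≤-trans (C2≤outside+bag x) (+-monoʳ-≤ _ (bags≤B x))))
    found : ∀ x → ∃ λ b → All (_∈ outside x) (vertices b)
    found x = bramble-element-in (outside x) (Unique.filter⁺ _ (pairs-unique n))
                                 (large 6 x 6+B≤) (large n x n+B≤)

treewidth≥ : ∀ {n} k → 6 + k ≤ n C 2 → n + k ≤ n C 2 →
             (D : TreeDecomposition (Kneser n 2)) (k′ : ℕ) → WidthAtMost D k′ → k ≤ k′
treewidth≥ k 6+k≤ n+k≤ D k′ width≤k′ with k ≤? k′
... | yes k≤k′ = k≤k′
... | no k≰k′ = ⊥-elim (¬bags≤ D k (λ x → ≤-trans (width≤k′ x) (≰⇒> k≰k′)) 6+k≤ n+k≤)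

module _ {A : Set} (T : Tree) (bags : Node T → List A) where

  InParent : A → Node T → Set
  InParent v zero = ⊥
  InParent v (suc i) = v ∈ bags (parent T i)

  TopAt : A → Node T → Set
  TopAt v r = v ∈ bags r × (∀ y → v ∈ bags y → y ≡ r ⊎ InParent v y)

  top⇒connected : ∀ {v r} → TopAt v r → ConnectedNonempty T (λ x → v ∈ bags x)
  top⇒connected {v} {r} (v∈r , upward) =
    (r , v∈r) , λ x y v∈x v∈y → walk-up x (Fin.toℕ<n x) v∈x ++ʷ reverseʷ (walk-up y (Fin.toℕ<n y) v∈y)
    where
    walk-up : ∀ {k} y → toℕ y <ℕ k → v ∈ bags y → WalkIn T (λ x → v ∈ bags x) y r
    walk-up y y<k v∈y with upward y v∈y
    walk-up y y<k v∈y | inj₁ refl = here v∈y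
    walk-up (suc i) (s≤s i<k) v∈y | inj₂ v∈pi =
      step v∈y (inj₁ (i , refl , refl)) (walk-up (parent T i) (≤-<-trans (parent< T i) i<k) v∈pi)

star : ℕ → Tree
star k = record { m = k ; parent = λ _ → zero ; parent< = λ _ → z≤n }

module StarDecomposition (k : ℕ) where

  n : ℕ
  n = suc (suc k)

  avoiding : Fin n → List (Pair n)
  avoiding j = filter (λ u → ¬? (j ∈? proj₁ u)) (pairs n)

  bags : Node (star n) → List (Pair (suc n))
  bags zero = map lift (pairs n)
  bags (suc j) = pairWith0 j ∷ map lift (avoiding j)

  bags-unique : ∀ x → Unique (bags x)
  bags-unique zero = Unique.map⁺ lift-injective (pairs-unique n)
  bags-unique (suc j) =
    All.tabulate (λ v∈ eq → pairWith0∉lifts (subst (_∈ map lift (avoiding j)) (sym eq) v∈))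
    ∷ Unique.map⁺ lift-injective (Unique.filter⁺ _ (pairs-unique n))

  top : ∀ v → ∃ (TopAt (star n) bags v)
  top (false ∷ s , eq) = zero , lift∈ , λ { zero _ → inj₁ refl ; (suc _) _ → inj₂ lift∈ }
    where lift∈ = ∈-map⁺ lift (∈-pairs n (s , eq))
  top (true ∷ s , eq) with j , refl ← ∣p∣≡1⇒p≡⁅x⁆ s (cong pred eq) = suc j , here (Pair-≡ refl) , only
    where
    only : ∀ y → (true ∷ ⁅ j ⁆ , eq) ∈ bags y → y ≡ suc j ⊎ InParent (star n) bags _ y
    only zero v∈ = ⊥-elim (pairWith0∉lifts v∈)
    only (suc j′) (here v≡) = inj₁ (cong suc (sym (pairWith0-injective (trans (Pair-≡ refl) v≡))))
    only (suc j′) (there v∈) = ⊥-elim (pairWith0∉lifts v∈)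

  lift∈leaf : ∀ j {u} → j ∉ᵖ u → lift u ∈ bags (suc j)
  lift∈leaf j {u} j∉u = there (∈-map⁺ lift (∈-filter⁺ (λ u → ¬? (j ∈? proj₁ u)) (∈-pairs n u) j∉u))

  covers : ∀ u v → Adj (Kneser (suc n) 2) u v → ∃ λ x → u ∈ bags x × v ∈ bags x
  covers (false ∷ _ , _) (false ∷ _ , _) _ = zero , ∈-map⁺ lift (∈-pairs n _) , ∈-map⁺ lift (∈-pairs n _)
  covers (true ∷ _ , _) (true ∷ _ , _) u~v = ⊥-elim (u~v (zero , here))
  covers (true ∷ s , eq) (false ∷ _ , _) u~v with j , refl ← ∣p∣≡1⇒p≡⁅x⁆ s (cong pred eq) =
    suc j , here (Pair-≡ refl) , lift∈leaf j λ j∈t → u~v (suc j , there (x∈p∩q⁺ (x∈⁅x⁆ j , j∈t)))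
  covers (false ∷ _ , _) (true ∷ t , eq) u~v with j , refl ← ∣p∣≡1⇒p≡⁅x⁆ t (cong pred eq) =
    suc j , lift∈leaf j (λ j∈s → u~v (suc j , there (x∈p∩q⁺ (j∈s , x∈⁅x⁆ j)))) , here (Pair-≡ refl)

  decomposition : TreeDecomposition (Kneser (suc n) 2)
  decomposition = record
    { tree = star n ; bag = bags ; bagUniq = bags-unique
    ; vertexOK = λ v → top⇒connected (star n) bags (proj₂ (top v)) ; edgeOK = covers }

  length-avoiding : ∀ j → length (avoiding j) <ℕ length (pairs n)
  length-avoiding j = filter-notAll (λ u → ¬? (j ∈? proj₁ u)) (pairs n)
                                    (lose (∈-pairs n (pair∋ j)) λ j∉ → j∉ (∋j j))
    where
    pair∋ : Fin n → Pair n
    pair∋ zero = pairWith0 zero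
    pair∋ (suc j) = pairWith0 j
    ∋j : ∀ j → j ∈ᵖ pair∋ j
    ∋j zero = here
    ∋j (suc j) = there (x∈⁅x⁆ j)

  width : WidthAtMost decomposition (n C 2 ∸ 1)
  width x = subst (length (bags x) ≤_) (sym (suc-∸1 (C2≥1 k)))
                  (≤-trans (bag≤ x) (≤-reflexive (length-pairs n)))
    where
    bag≤ : ∀ x → length (bags x) ≤ length (pairs n)
    bag≤ zero = ≤-reflexive (length-map lift (pairs n))
    bag≤ (suc j) = subst (λ ℓ → suc ℓ ≤ length (pairs n)) (sym (length-map lift (avoiding j)))
                         (length-avoiding j)

module _ {n : ℕ} (T : Tree) (bags : Node T → List (Pair n)) where

  open import Data.List.Membership.DecPropositional (_≟ᵖ_ {n}) using () renaming (_∈?_ to _∈ᴸ?_)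
  open import Data.List.Relation.Unary.Unique.DecPropositional (_≟ᵖ_ {n}) using (unique?)

  Valid : Set
  Valid = (∀ x → Unique (bags x))
        × All (λ v → ∃ (TopAt T bags v)) (pairs n)
        × All (λ u → All (λ v → u ~ v → ∃ λ x → u ∈ bags x × v ∈ bags x) (pairs n)) (pairs n)

  valid? : Dec Valid
  valid? = Fin.all? (unique? ∘ bags)
      ×-dec All.all? (λ v → Fin.any? (topAt? v)) (pairs n)
      ×-dec All.all? (λ u → All.all? (λ v → (u ~? v) →-dec covered? u v) (pairs n)) (pairs n)
    where
    inParent? : ∀ v y → Dec (InParent T bags v y)
    inParent? v zero = no λ ()
    inParent? v (suc i) = v ∈ᴸ? bags (parent T i)
    topAt? : ∀ v r → Dec (TopAt T bags v r)
    topAt? v r = (v ∈ᴸ? bags r) ×-dec Fin.all? λ y → (v ∈ᴸ? bags y) →-dec ((y Fin.≟ r) ⊎-dec inParent? v y)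
    covered? : ∀ u v → Dec (∃ λ x → u ∈ bags x × v ∈ bags x)
    covered? u v = Fin.any? λ x → (u ∈ᴸ? bags x) ×-dec (v ∈ᴸ? bags x)

  valid⇒decomposition : Valid → TreeDecomposition (Kneser n 2)
  valid⇒decomposition (unique , tops , covered) = record
    { tree = T ; bag = bags ; bagUniq = unique
    ; vertexOK = λ v → top⇒connected T bags (proj₂ (All.lookup tops (∈-pairs n v)))
    ; edgeOK = λ u v u~v → All.lookup (All.lookup covered (∈-pairs n u)) (∈-pairs n v) (Adj⇒~ u~v) }

explicit-decomposition : ∀ {n} (T : Tree) (bags : Node T → List (Pair n)) (k : ℕ) →
                         {valid : True (valid? T bags)} →
                         {narrow : True (Fin.all? λ x → length (bags x) ≤? suc k)} →
                         Σ (TreeDecomposition (Kneser n 2)) λ D → WidthAtMost D k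
explicit-decomposition T bags k {valid} {narrow} =
  valid⇒decomposition T bags (toWitness valid) , toWitness narrow

⟪_,_⟫ : ∀ {n} (i j : ℕ) {i<n : True (i ℕ.<? n)} {j<n : True (j ℕ.<? n)} →
        {size : True (∣ ⁅ #_ i {n} {i<n} ⁆ ∪ ⁅ #_ j {n} {j<n} ⁆ ∣ ℕ.≟ 2)} → Pair n
⟪ i , j ⟫ {i<n} {j<n} {size} = ⁅ #_ i {_} {i<n} ⁆ ∪ ⁅ #_ j {_} {j<n} ⁆ , toWitness size

treeOf : ∀ {k} (parents : Vec (Fin (suc k)) k) →
         {ordered : True (Fin.all? λ i → toℕ (lookup parents i) ≤? toℕ i)} → Tree
treeOf {k} parents {ordered} = record { m = k ; parent = lookup parents ; parent< = toWitness ordered }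

kneser-1 : Σ (TreeDecomposition (Kneser 1 2)) λ D → WidthAtMost D 0
kneser-1 = explicit-decomposition (star 0) (λ _ → []) 0

kneser-2 : Σ (TreeDecomposition (Kneser 2 2)) λ D → WidthAtMost D 0
kneser-2 = explicit-decomposition (star 0) (λ _ → ⟪ 0 , 1 ⟫ ∷ []) 0

kneser-3 : Σ (TreeDecomposition (Kneser 3 2)) λ D → WidthAtMost D 0
kneser-3 = explicit-decomposition (star 2)
  (lookup ((⟪ 0 , 1 ⟫ ∷ []) ∷ (⟪ 0 , 2 ⟫ ∷ []) ∷ (⟪ 1 , 2 ⟫ ∷ []) ∷ [])) 0

kneser-4 : Σ (TreeDecomposition (Kneser 4 2)) λ D → WidthAtMost D 1
kneser-4 = explicit-decomposition (star 2)
  (lookup ( (⟪ 0 , 1 ⟫ ∷ ⟪ 2 , 3 ⟫ ∷ [])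
          ∷ (⟪ 0 , 2 ⟫ ∷ ⟪ 1 , 3 ⟫ ∷ [])
          ∷ (⟪ 0 , 3 ⟫ ∷ ⟪ 1 , 2 ⟫ ∷ [])
          ∷ [])) 1

-- The root holds the star at 0. Each edge e ~ f among the pairs inside {1,2,3,4} gets a
-- child holding the star and e, and a grandchild holding e, f and the two neighbours of f at 0.
kneser-5 : Σ (TreeDecomposition (Kneser 5 2)) λ D → WidthAtMost D 4
kneser-5 = explicit-decomposition (treeOf (# 0 ∷ # 0 ∷ # 0 ∷ # 1 ∷ # 2 ∷ # 3 ∷ []))
  (lookup ( (⟪ 0 , 1 ⟫ ∷ ⟪ 0 , 2 ⟫ ∷ ⟪ 0 , 3 ⟫ ∷ ⟪ 0 , 4 ⟫ ∷ [])
          ∷ (⟪ 0 , 1 ⟫ ∷ ⟪ 0 , 2 ⟫ ∷ ⟪ 0 , 3 ⟫ ∷ ⟪ 0 , 4 ⟫ ∷ ⟪ 1 , 2 ⟫ ∷ [])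
          ∷ (⟪ 0 , 1 ⟫ ∷ ⟪ 0 , 2 ⟫ ∷ ⟪ 0 , 3 ⟫ ∷ ⟪ 0 , 4 ⟫ ∷ ⟪ 1 , 3 ⟫ ∷ [])
          ∷ (⟪ 0 , 1 ⟫ ∷ ⟪ 0 , 2 ⟫ ∷ ⟪ 0 , 3 ⟫ ∷ ⟪ 0 , 4 ⟫ ∷ ⟪ 1 , 4 ⟫ ∷ [])
          ∷ (⟪ 1 , 2 ⟫ ∷ ⟪ 3 , 4 ⟫ ∷ ⟪ 0 , 1 ⟫ ∷ ⟪ 0 , 2 ⟫ ∷ [])
          ∷ (⟪ 1 , 3 ⟫ ∷ ⟪ 2 , 4 ⟫ ∷ ⟪ 0 , 1 ⟫ ∷ ⟪ 0 , 3 ⟫ ∷ [])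
          ∷ (⟪ 1 , 4 ⟫ ∷ ⟪ 2 , 3 ⟫ ∷ ⟪ 0 , 1 ⟫ ∷ ⟪ 0 , 4 ⟫ ∷ [])
          ∷ [])) 4

width≥1 : ∀ {G : Graph} {u v : V G} → Adj G u v → u ≢ v →
          (D : TreeDecomposition G) (k : ℕ) → WidthAtMost D k → 1 ≤ k
width≥1 {u = u} {v} u~v u≢v D zero width≤0 with x , u∈ , v∈ ← edgeOK D u v u~v =
  ⊥-elim (u≢v (singleton (width≤0 x) u∈ v∈))
  where
  singleton : ∀ {A : Set} {xs : List A} {a b} → length xs ≤ 1 → a ∈ xs → b ∈ xs → a ≡ b
  singleton {xs = _ ∷ []} _ (here refl) (here refl) = refl
  singleton {xs = _ ∷ _ ∷ _} (s≤s ()) _ _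
width≥1 _ _ _ (suc k) _ = s≤s z≤n

treewidth-0 : ∀ {G} → Σ (TreeDecomposition G) (λ D → WidthAtMost D 0) → TreewidthIs G 0
treewidth-0 D = D , λ _ _ _ → z≤n

treewidth-≤3 : ∀ n → 1 ≤ n → n ≤ 3 → TreewidthIs (Kneser n 2) 0
treewidth-≤3 1 _ _ = treewidth-0 kneser-1
treewidth-≤3 2 _ _ = treewidth-0 kneser-2
treewidth-≤3 3 _ _ = treewidth-0 kneser-3
treewidth-≤3 (suc (suc (suc (suc _)))) _ (s≤s (s≤s (s≤s ())))

treewidth-4 : TreewidthIs (Kneser 4 2) 1
treewidth-4 = kneser-4 , width≥1 (~⇒Adj 01~23) (~⇒≢ 01~23)
  where
  01~23 : ⟪ 0 , 1 ⟫ ~ ⟪ 2 , 3 ⟫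
  01~23 = toWitness {a? = ⟪ 0 , 1 ⟫ ~? ⟪ 2 , 3 ⟫} tt

treewidth-5 : TreewidthIs (Kneser 5 2) 4
treewidth-5 = kneser-5 , treewidth≥ 4 ≤-refl (n≤1+n 9)

treewidth-≥6 : ∀ n → 6 ≤ n → TreewidthIs (Kneser n 2) (((n ∸ 1) C 2) ∸ 1)
treewidth-≥6 1 (s≤s ())
treewidth-≥6 2 (s≤s (s≤s ()))
treewidth-≥6 (suc (suc (suc k))) 6≤n =
  (decomposition , width) , treewidth≥ _ (≤-trans (+-monoˡ-≤ _ 6≤n) n+w≤) n+w≤
  where
  open StarDecomposition k
  n+w≤ : suc n + (n C 2 ∸ 1) ≤ suc n C 2
  n+w≤ = ≤-reflexive (begin
    suc n + (n C 2 ∸ 1)   ≡⟨ +-suc n (n C 2 ∸ 1) ⟨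
    n + suc (n C 2 ∸ 1)   ≡⟨ cong (n +_) (suc-∸1 (C2≥1 k)) ⟩
    n + n C 2             ≡⟨ C2-suc n ⟨
    suc n C 2             ∎)
    where open ≡-Reasoning

theorem2 : (n : ℕ) → 1 ≤ n →
    ((n ≤ 3 → TreewidthIs (Kneser n 2) 0) ×
     (n ≡ 4 → TreewidthIs (Kneser n 2) 1) ×
     (n ≡ 5 → TreewidthIs (Kneser n 2) 4) ×
     (6 ≤ n → TreewidthIs (Kneser n 2) (((n ∸ 1) C 2) ∸ 1)))
theorem2 n 1≤n =
  treewidth-≤3 n 1≤n , (λ { refl → treewidth-4 }) , (λ { refl → treewidth-5 }) , treewidth-≥6 n
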